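{- Let $\mathcal{M}$ be a Kripke model of $\mathrm{PRED2}_0$, $u$ a valuation, $x\in V_\tau$, $t\in T_\tau$, $\varphi\in T_o$, and $u'=u[x/[\![t]\!]_u]$. Then for every state $s$: $s,u\Vdash\varphi[x/t]$ if and only if $s,u'\Vdash\varphi$.
   Context: $\mathrm{PRED2}_0$: fix a finite set $\mathcal{B}$ of base types; types are $\mathcal{T}::= o\mid \beta\mid \beta\to\tau$ ($\beta\in\mathcal{B}$). For each type $\tau$: a countable set $V_\tau$ of variables (unique type per variable) and a countable set $\Sigma_\tau$ of constants. Terms $T_\tau$: variables in $V_\tau$, constants in $\Sigma_\tau$, applications $t\,s$ with $t\in T_{\sigma\to\tau}$, $s\in T_\sigma$, $\sigma\in\mathcal{B}$; formulas ($T_o$) additionally include $\varphi\supset\psi$ and $\forall x.\varphi$ for $x\in V_\tau$, $\tau\in\mathcal{B}\cup\{o\}$. Formulas are identified up to $\alpha$-equivalence; $\varphi[x/t]$ is capture-avoiding substitution. A Kripke pre-model is $(\mathcal{S},\le,\{\mathcal{D}_\tau\},\cdot,I,\varsigma)$: states $\mathcal{S}$ with partial order $\le$; nonempty sets $\mathcal{D}_\tau$; an operation $\cdot$ with $d_1\cdot d_2\in\mathcal{D}_{\tau_2}$ for $d_1\in\mathcal{D}_{\tau_1\to\tau_2}$, $d_2\in\mathcal{D}_{\tau_1}$; $I(c)\in\mathcal{D}_\tau$ for $c\in\Sigma_\tau$; $\varsigma$ assigning upward-closed subsets of $\mathcal{S}$ to elements of $\mathcal{D}_o$. A valuation $u$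 maps $V_\tau$ into $\mathcal{D}_\tau$; $u[x/d]$ is the updated valuation. For each valuation $u$ there is an interpretation $[\![\cdot]\!]_u$ sending terms of type $\tau$ to $\mathcal{D}_\tau$ with $[\![x]\!]_u=u(x)$, $[\![c]\!]_u=I(c)$, $[\![t_1t_2]\!]_u=[\![t_1]\!]_u\cdot[\![t_2]\!]_u$. $s,u\Vdash\varphi$ means $s\in\varsigma([\![\varphi]\!]_u)$. A Kripke model is a pre-model in which for all $s,u$: $s,u\Vdash\varphi\supset\psi$ iff every $s'\ge s$ with $s',u\Vdash\varphi$ has $s',u\Vdash\psi$; $s,u\Vdash\forall x.\varphi$ ($x\in V_\tau$) iff $s',u[x/d]\Vdash\varphi$ for all $s'\ge s$, $d\in\mathcal{D}_\tau$; $s,u\not\Vdash\forall p.p$ for $p\in V_o$. -}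

module Defs where

open import Data.Nat using (ℕ; zero; suc; _≤?_)
import Data.Nat as ℕ
open import Data.Fin using (Fin)
import Data.Fin as Fin
open import Data.Product using (_×_; _,_)
open import Relation.Nullary using (Dec; yes; no; ¬_)
open import Relation.Binary.PropositionalEquality using (_≡_; refl; cong; cong₂)
open import Relation.Binary.Structures using (IsPartialOrder)
open import Function.Bundles using (_⇔_; _↣_)

-- Types of PRED2_0 over the finite set of base types  B = Fin k
--   T ::= o | β | β → τ   (β ∈ B)

data Ty (k : ℕ) : Set where
  o   : Ty k
  ι   : Fin k → Ty k
  _⇒_ : Fin k → Ty k → Ty k

infixr 5 _⇒_

_≟Ty_ : ∀ {k} (σ τ : Ty k) → Dec (σ ≡ τ)
o ≟Ty o = yes refl
o ≟Ty ι _ = no λ ()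
o ≟Ty (_ ⇒ _) = no λ ()
ι _ ≟Ty o = no λ ()
ι β ≟Ty ι γ with β Fin.≟ γ
... | yes refl = yes refl
... | no ne = no λ { refl → ne refl }
ι _ ≟Ty (_ ⇒ _) = no λ ()
(_ ⇒ _) ≟Ty o = no λ ()
(_ ⇒ _) ≟Ty ι _ = no λ ()
(β ⇒ σ) ≟Ty (γ ⇒ τ) with β Fin.≟ γ | σ ≟Ty τ
... | yes refl | yes refl = yes refl
... | no ne | _ = no λ { refl → ne refl }
... | yes _ | no ne = no λ { refl → ne refl }

data Quant {k : ℕ} : Ty k → Set where
  qo : Quant o
  qβ : (β : Fin k) → Quant (ι β)

-- Terms, with variables as de Bruijn indices (so terms are taken up to
-- α-equivalence).  For each type τ the variable set V_τ is ℕ: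
-- 'var τ n' is the n-th variable of type τ.  The binder 'all τ q φ'
-- binds the variable 'var τ 0' in φ; the free variables of type τ of φ
-- are shifted by one underneath it (variables of other types are not).

data Tm {k : ℕ} (Con : Ty k → Set) : Ty k → Set where
  var : (τ : Ty k) → ℕ → Tm Con τ
  con : ∀ {τ} → Con τ → Tm Con τ
  app : ∀ {β τ} → Tm Con (β ⇒ τ) → Tm Con (ι β) → Tm Con τ
  imp : Tm Con o → Tm Con o → Tm Con o
  all : (τ : Ty k) → Quant τ → Tm Con o → Tm Con o

module _ {k : ℕ} {Con : Ty k → Set} where

  shift : ∀ {τ} → Ty k → ℕ → Tm Con τ → Tm Con τ
  shift σ c (var τ n) with τ ≟Ty σ | c ≤? n
  ... | yes _ | yes _ = var τ (suc n)
  ... | _     | _     = var τ n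
  shift σ c (con a) = con a
  shift σ c (app t s) = app (shift σ c t) (shift σ c s)
  shift σ c (imp φ ψ) = imp (shift σ c φ) (shift σ c ψ)
  shift σ c (all τ q φ) with τ ≟Ty σ
  ... | yes _ = all τ q (shift σ (suc c) φ)
  ... | no  _ = all τ q (shift σ c φ)

  _[_,_≔_] : ∀ {τ} → Tm Con τ → (σ : Ty k) → ℕ → Tm Con σ → Tm Con τ
  var τ m [ σ , n ≔ t ] with τ ≟Ty σ | m ℕ.≟ n
  ... | yes refl | yes _ = t
  ... | _        | _     = var τ m
  con a [ σ , n ≔ t ] = con a
  app f s [ σ , n ≔ t ] = app (f [ σ , n ≔ t ]) (s [ σ , n ≔ t ])
  imp φ ψ [ σ , n ≔ t ] = imp (φ [ σ , n ≔ t ]) (ψ [ σ , n ≔ t ])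
  all τ q φ [ σ , n ≔ t ] with τ ≟Ty σ
  ... | yes _ = all τ q (φ [ σ , suc n ≔ shift τ 0 t ])
  ... | no  _ = all τ q (φ [ σ , n ≔ shift τ 0 t ])

Valuation : ∀ {k} → (Ty k → Set) → Set
Valuation {k} D = (τ : Ty k) → ℕ → D τ

module _ {k : ℕ} {D : Ty k → Set} where

  update : Valuation D → (σ : Ty k) → ℕ → D σ → Valuation D
  update u σ n d τ m with τ ≟Ty σ | m ℕ.≟ n
  ... | yes refl | yes _ = d
  ... | _        | _     = u τ m

  -- the valuation used under a binder of type σ: the bound variable
  -- (index 0 of type σ) gets the value d, the other variables of type σ
  -- are shifted
  extend : Valuation D → (σ : Ty k) → D σ → Valuation D
  extend u σ d τ m with τ ≟Ty σ
  extend u σ d τ zero    | yes refl = d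
  extend u σ d τ (suc m) | yes refl = u τ m
  extend u σ d τ m       | no _     = u τ m

record PreModel {k : ℕ} (Con : Ty k → Set) : Set₁ where
  field
    S       : Set
    _≤_     : S → S → Set
    ≤-po    : IsPartialOrder _≡_ _≤_
    D       : Ty k → Set
    D-ne    : (τ : Ty k) → D τ
    _·_     : ∀ {β τ} → D (β ⇒ τ) → D (ι β) → D τ
    I       : ∀ {τ} → Con τ → D τ
    ς       : D o → S → Set
    ς-up    : ∀ d {s s'} → s ≤ s' → ς d s → ς d s'
    ⟦_⟧_    : ∀ {τ} → Tm Con τ → Valuation D → D τ
    ⟦var⟧   : ∀ u τ n → ⟦ var τ n ⟧ u ≡ u τ n
    ⟦con⟧   : ∀ u {τ} (c : Con τ) → ⟦ con c ⟧ u ≡ I c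
    ⟦app⟧   : ∀ u {β τ} (t₁ : Tm Con (β ⇒ τ)) (t₂ : Tm Con (ι β)) →
              ⟦ app t₁ t₂ ⟧ u ≡ (⟦ t₁ ⟧ u) · (⟦ t₂ ⟧ u)

  _,_⊩_ : S → Valuation D → Tm Con o → Set
  s , u ⊩ φ = ς (⟦ φ ⟧ u) s

record IsKripke {k : ℕ} {Con : Ty k → Set} (M : PreModel Con) : Set where
  open PreModel M
  field
    ⊩-imp : ∀ s u (φ ψ : Tm Con o) →
            (s , u ⊩ imp φ ψ) ⇔ (∀ s' → s ≤ s' → s' , u ⊩ φ → s' , u ⊩ ψ)
    ⊩-all : ∀ s u τ (q : Quant τ) (φ : Tm Con o) →
            (s , u ⊩ all τ q φ) ⇔ (∀ s' → s ≤ s' → (d : D τ) → s' , extend u τ d ⊩ φ)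
    ⊩-⊥   : ∀ s u → ¬ (s , u ⊩ all o qo (var o 0))

module Submission where

-- Evaluation ⟦_⟧ is only required to be compositional on variables,
-- constants and application; on implications and quantifiers the
-- Kripke clauses merely determine at which states a formula is forced.
-- So the lemma is proved up to "agreement" ≈[ τ ]: equality of values
-- at base and function types, equal forcing at every state at type o.

open import Defs
open import Data.Nat using (ℕ; zero; suc; _≤?_; s≤s; s≤s⁻¹)
import Data.Nat as ℕ
open import Data.Nat.Properties using (suc-injective)
open import Relation.Nullary using (yes; no; contradiction)
open import Relation.Binary.Bundles using (Setoid)
open import Relation.Binary.PropositionalEquality
  using (_≡_; _≢_; _≗_; refl; sym; trans; cong; cong₂; subst₂; ≡-≟-identity; ≢-≟-identity)
open import Function.Bundles using (_⇔_; _↣_; mk⇔; Equivalence)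
import Function.Properties.Equivalence as ⇔
import Relation.Binary.Reasoning.Setoid as SetoidReasoning

-- Type equality decides to 'yes refl' on equal types; this lets the
-- case distinctions inside extend, update and modify compute.
≟Ty-refl : ∀ {k} (σ : Ty k) → σ ≟Ty σ ≡ yes refl
≟Ty-refl σ = ≡-≟-identity _≟Ty_ refl

-- Operations on sequences ℕ → A: each type component of a valuation is
-- such a sequence.
module Sequences {A : Set} where

  Extensional : ((ℕ → A) → ℕ → A) → Set
  Extensional g = ∀ {f f'} → f ≗ f' → g f ≗ g f'

  push : A → (ℕ → A) → ℕ → A
  push d f zero    = d
  push d f (suc m) = f m

  overwrite : ℕ → A → (ℕ → A) → ℕ → A
  overwrite n b f m with m ℕ.≟ n
  ... | yes _ = b
  ... | no  _ = f m

  -- drop the entry at position c, reindexing from c on (the semantic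
  -- counterpart of shifting the variables ≥ c)
  skipFrom : ℕ → (ℕ → A) → ℕ → A
  skipFrom c f m with c ≤? m
  ... | yes _ = f (suc m)
  ... | no  _ = f m

  push-ext : ∀ d → Extensional (push d)
  push-ext d f≗f' zero    = refl
  push-ext d f≗f' (suc m) = f≗f' m

  overwrite-ext : ∀ n b → Extensional (overwrite n b)
  overwrite-ext n b f≗f' m with m ℕ.≟ n
  ... | yes _ = refl
  ... | no  _ = f≗f' m

  skipFrom-ext : ∀ c → Extensional (skipFrom c)
  skipFrom-ext c f≗f' m with c ≤? m
  ... | yes _ = f≗f' (suc m)
  ... | no  _ = f≗f' m

  skipFrom-push : ∀ c d f → skipFrom (suc c) (push d f) ≗ push d (skipFrom c f)
  skipFrom-push c d f zero = refl
  skipFrom-push c d f (suc m) with suc c ≤? suc m | c ≤? m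
  ... | yes _  | yes _  = refl
  ... | no  _  | no  _  = refl
  ... | yes p  | no ¬p  = contradiction (s≤s⁻¹ p) ¬p
  ... | no ¬p  | yes p  = contradiction (s≤s p) ¬p

  skipFrom-zero-push : ∀ d f → skipFrom 0 (push d f) ≗ f
  skipFrom-zero-push d f m = refl

  overwrite-push : ∀ n b d f → overwrite (suc n) b (push d f) ≗ push d (overwrite n b f)
  overwrite-push n b d f zero = refl
  overwrite-push n b d f (suc m) with suc m ℕ.≟ suc n | m ℕ.≟ n
  ... | yes _  | yes _  = refl
  ... | no  _  | no  _  = refl
  ... | yes p  | no ¬p  = contradiction (suc-injective p) ¬p
  ... | no ¬p  | yes p  = contradiction (cong suc p) ¬p

module Valuations {k : ℕ} {D : Ty k → Set} where
  open Sequences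

  infix 4 _≗ᵥ_

  _≗ᵥ_ : Valuation D → Valuation D → Set
  u ≗ᵥ v = ∀ τ n → u τ n ≡ v τ n

  ≗ᵥ-setoid : Setoid _ _
  ≗ᵥ-setoid = record
    { Carrier       = Valuation D
    ; _≈_           = _≗ᵥ_
    ; isEquivalence = record
      { refl  = λ τ n → refl
      ; sym   = λ p τ n → sym (p τ n)
      ; trans = λ p q τ n → trans (p τ n) (q τ n)
      }
    }

  open SetoidReasoning ≗ᵥ-setoid

  modify : (σ : Ty k) → ((ℕ → D σ) → ℕ → D σ) → Valuation D → Valuation D
  modify σ g v τ m with τ ≟Ty σ
  ... | yes refl = g (v τ) m
  ... | no  _    = v τ m

  modify-≡ : ∀ σ g v m → modify σ g v σ m ≡ g (v σ) m
  modify-≡ σ g v m rewrite ≟Ty-refl σ = refl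

  modify-≢ : ∀ {σ τ} g v m → τ ≢ σ → modify σ g v τ m ≡ v τ m
  modify-≢ g v m τ≢σ rewrite ≢-≟-identity _≟Ty_ τ≢σ = refl

  extend-as-modify : ∀ v σ d → extend v σ d ≗ᵥ modify σ (push d) v
  extend-as-modify v σ d τ m with τ ≟Ty σ
  extend-as-modify v σ d τ zero    | yes refl = refl
  extend-as-modify v σ d τ (suc m) | yes refl = refl
  extend-as-modify v σ d τ m       | no _     = refl

  update-as-modify : ∀ v σ n b → update v σ n b ≗ᵥ modify σ (overwrite n b) v
  update-as-modify v σ n b τ m with τ ≟Ty σ
  ... | no _ = refl
  ... | yes refl with m ℕ.≟ n
  ...   | yes _ = refl
  ...   | no  _ = refl

  modify-cong : ∀ σ {g} → Extensional g → ∀ {v w} → v ≗ᵥ w → modify σ g v ≗ᵥ modify σ g w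
  modify-cong σ g-ext v≗w τ m with τ ≟Ty σ
  ... | yes refl = g-ext (v≗w τ) m
  ... | no  _    = v≗w τ m

  extend-cong : ∀ σ d {v w} → v ≗ᵥ w → extend v σ d ≗ᵥ extend w σ d
  extend-cong σ d v≗w τ m with τ ≟Ty σ
  extend-cong σ d v≗w τ zero    | yes refl = refl
  extend-cong σ d v≗w τ (suc m) | yes refl = v≗w τ m
  extend-cong σ d v≗w τ m       | no _     = v≗w τ m

  modify-swap-≡ : ∀ σ {g h g' h'} → Extensional g → Extensional g' →
    (∀ f → g (h f) ≗ g' (h' f)) → ∀ v → modify σ g (modify σ h v) ≗ᵥ modify σ g' (modify σ h' v)
  modify-swap-≡ σ {h = h} {h' = h'} g-ext g'-ext law v τ m with τ ≟Ty σ
  ... | yes refl = trans (g-ext (modify-≡ τ h v) m) (trans (law (v τ) m) (sym (g'-ext (modify-≡ τ h' v) m)))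
  ... | no τ≢σ   = trans (modify-≢ h v m τ≢σ) (sym (modify-≢ h' v m τ≢σ))

  modify-swap-≢ : ∀ {σ ρ g h} → ρ ≢ σ → Extensional g → Extensional h →
    ∀ v → modify σ g (modify ρ h v) ≗ᵥ modify ρ h (modify σ g v)
  modify-swap-≢ {σ} {ρ} {g} {h} ρ≢σ g-ext h-ext v τ m with τ ≟Ty σ | τ ≟Ty ρ
  ... | yes refl | yes refl = contradiction refl ρ≢σ
  ... | yes refl | no τ≢ρ   = trans (g-ext (λ i → modify-≢ h v i τ≢ρ) m) (sym (modify-≡ τ g v m))
  ... | no τ≢σ   | yes refl = trans (modify-≡ τ h v m) (sym (h-ext (λ i → modify-≢ g v i τ≢σ) m))
  ... | no τ≢σ   | no τ≢ρ   = trans (modify-≢ h v m τ≢ρ) (sym (modify-≢ g v m τ≢σ))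

  modify-cancel : ∀ σ {g h} → Extensional g → (∀ f → g (h f) ≗ f) → ∀ v → modify σ g (modify σ h v) ≗ᵥ v
  modify-cancel σ {h = h} g-ext law v τ m with τ ≟Ty σ
  ... | yes refl = trans (g-ext (modify-≡ τ h v) m) (law (v τ) m)
  ... | no τ≢σ   = modify-≢ h v m τ≢σ

  modify-extend-≡ : ∀ σ d {g g'} → Extensional g → (∀ f → g (push d f) ≗ push d (g' f)) →
    ∀ v → modify σ g (extend v σ d) ≗ᵥ extend (modify σ g' v) σ d
  modify-extend-≡ σ d {g} {g'} g-ext law v = begin
    modify σ g (extend v σ d)          ≈⟨ modify-cong σ g-ext (extend-as-modify v σ d) ⟩
    modify σ g (modify σ (push d) v)   ≈⟨ modify-swap-≡ σ g-ext (push-ext d) law v ⟩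
    modify σ (push d) (modify σ g' v)  ≈⟨ extend-as-modify (modify σ g' v) σ d ⟨
    extend (modify σ g' v) σ d         ∎

  modify-extend-≢ : ∀ {σ ρ} d {g} → ρ ≢ σ → Extensional g →
    ∀ v → modify σ g (extend v ρ d) ≗ᵥ extend (modify σ g v) ρ d
  modify-extend-≢ {σ} {ρ} d {g} ρ≢σ g-ext v = begin
    modify σ g (extend v ρ d)          ≈⟨ modify-cong σ g-ext (extend-as-modify v ρ d) ⟩
    modify σ g (modify ρ (push d) v)   ≈⟨ modify-swap-≢ ρ≢σ g-ext (push-ext d) v ⟩
    modify ρ (push d) (modify σ g v)   ≈⟨ extend-as-modify (modify σ g v) ρ d ⟨
    extend (modify σ g v) ρ d          ∎

  modify-extend-cancel : ∀ σ d {g} → Extensional g → (∀ f → g (push d f) ≗ f) →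
    ∀ v → modify σ g (extend v σ d) ≗ᵥ v
  modify-extend-cancel σ d {g} g-ext law v = begin
    modify σ g (extend v σ d)          ≈⟨ modify-cong σ g-ext (extend-as-modify v σ d) ⟩
    modify σ g (modify σ (push d) v)   ≈⟨ modify-cancel σ g-ext law v ⟩
    v                                  ∎

  -- the valuation matching 'shift σ c': variables of type σ at
  -- positions ≥ c are read one position further up
  skip : Valuation D → Ty k → ℕ → Valuation D
  skip v σ c = modify σ (skipFrom c) v

  skip-extend-≡ : ∀ v σ c d → skip (extend v σ d) σ (suc c) ≗ᵥ extend (skip v σ c) σ d
  skip-extend-≡ v σ c d = modify-extend-≡ σ d (skipFrom-ext (suc c)) (skipFrom-push c d) v

  skip-extend-≢ : ∀ v {σ τ} c d → τ ≢ σ → skip (extend v τ d) σ c ≗ᵥ extend (skip v σ c) τ d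
  skip-extend-≢ v c d τ≢σ = modify-extend-≢ d τ≢σ (skipFrom-ext c) v

  skip-extend-zero : ∀ v σ d → skip (extend v σ d) σ 0 ≗ᵥ v
  skip-extend-zero v σ d = modify-extend-cancel σ d (skipFrom-ext 0) (skipFrom-zero-push d) v

  update-extend-≡ : ∀ v σ n b d → update (extend v σ d) σ (suc n) b ≗ᵥ extend (update v σ n b) σ d
  update-extend-≡ v σ n b d = begin
    update (extend v σ d) σ (suc n) b            ≈⟨ update-as-modify (extend v σ d) σ (suc n) b ⟩
    modify σ (overwrite (suc n) b) (extend v σ d) ≈⟨ modify-extend-≡ σ d (overwrite-ext (suc n) b) (overwrite-push n b d) v ⟩
    extend (modify σ (overwrite n b) v) σ d      ≈⟨ extend-cong σ d (update-as-modify v σ n b) ⟨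
    extend (update v σ n b) σ d                  ∎

  update-extend-≢ : ∀ v {σ τ} n b d → τ ≢ σ → update (extend v τ d) σ n b ≗ᵥ extend (update v σ n b) τ d
  update-extend-≢ v {σ} {τ} n b d τ≢σ = begin
    update (extend v τ d) σ n b              ≈⟨ update-as-modify (extend v τ d) σ n b ⟩
    modify σ (overwrite n b) (extend v τ d)  ≈⟨ modify-extend-≢ d τ≢σ (overwrite-ext n b) v ⟩
    extend (modify σ (overwrite n b) v) τ d  ≈⟨ extend-cong τ d (update-as-modify v σ n b) ⟨
    extend (update v σ n b) τ d              ∎

module Semantics {k : ℕ} {Con : Ty k → Set} (M : PreModel Con) (K : IsKripke M) where
  open PreModel M
  open IsKripke K
  open Valuations {D = D}
  open Equivalence using (to; from)

  Agree : (τ : Ty k) → D τ → D τ → Set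
  Agree o       a b = ∀ s → ς a s ⇔ ς b s
  Agree (ι β)   a b = a ≡ b
  Agree (β ⇒ τ) a b = a ≡ b

  infix 4 Agree
  syntax Agree τ a b = a ≈[ τ ] b

  ≈-refl : ∀ τ {a} → a ≈[ τ ] a
  ≈-refl o       s = ⇔.refl
  ≈-refl (ι β)     = refl
  ≈-refl (β ⇒ τ)   = refl

  ≈-reflexive : ∀ {τ a b} → a ≡ b → a ≈[ τ ] b
  ≈-reflexive {τ} refl = ≈-refl τ

  ≈-trans : ∀ {τ a b c} → a ≈[ τ ] b → b ≈[ τ ] c → a ≈[ τ ] c
  ≈-trans {o}     p q s = ⇔.trans (p s) (q s)
  ≈-trans {ι β}   p q   = trans p q
  ≈-trans {β ⇒ τ} p q   = trans p q

  infix 4 _≈ᵥ_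

  _≈ᵥ_ : Valuation D → Valuation D → Set
  u ≈ᵥ v = ∀ τ n → u τ n ≈[ τ ] v τ n

  ≗ᵥ⇒≈ᵥ : ∀ {u v} → u ≗ᵥ v → u ≈ᵥ v
  ≗ᵥ⇒≈ᵥ u≗v τ n = ≈-reflexive (u≗v τ n)

  ≈ᵥ-trans : ∀ {u v w} → u ≈ᵥ v → v ≈ᵥ w → u ≈ᵥ w
  ≈ᵥ-trans u≈v v≈w τ n = ≈-trans (u≈v τ n) (v≈w τ n)

  ≈ᵥ-extend : ∀ {u v} τ d → u ≈ᵥ v → extend u τ d ≈ᵥ extend v τ d
  ≈ᵥ-extend τ d u≈v ρ m with ρ ≟Ty τ
  ≈ᵥ-extend τ d u≈v ρ zero    | yes refl = ≈-refl ρ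
  ≈ᵥ-extend τ d u≈v ρ (suc m) | yes refl = u≈v ρ m
  ≈ᵥ-extend τ d u≈v ρ m       | no _     = u≈v ρ m

  ≈ᵥ-update : ∀ w σ n {a b} → a ≈[ σ ] b → update w σ n a ≈ᵥ update w σ n b
  ≈ᵥ-update w σ n a≈b τ m with τ ≟Ty σ | m ℕ.≟ n
  ... | yes refl | yes _ = a≈b
  ... | yes refl | no  _ = ≈-refl τ
  ... | no  _    | yes _ = ≈-refl τ
  ... | no  _    | no  _ = ≈-refl τ

  var-cong : ∀ {u v} τ n → u τ n ≈[ τ ] v τ n → ⟦ var τ n ⟧ u ≈[ τ ] ⟦ var τ n ⟧ v
  var-cong {u} {v} τ n = subst₂ (Agree τ) (sym (⟦var⟧ u τ n)) (sym (⟦var⟧ v τ n))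

  con-cong : ∀ {u v τ} (c : Con τ) → ⟦ con c ⟧ u ≈[ τ ] ⟦ con c ⟧ v
  con-cong {u} {v} c = ≈-reflexive (trans (⟦con⟧ u c) (sym (⟦con⟧ v c)))

  app-cong : ∀ {u v β τ} {f f' : Tm Con (β ⇒ τ)} {t t' : Tm Con (ι β)} →
    ⟦ f ⟧ u ≡ ⟦ f' ⟧ v → ⟦ t ⟧ u ≡ ⟦ t' ⟧ v → ⟦ app f t ⟧ u ≈[ τ ] ⟦ app f' t' ⟧ v
  app-cong {u} {v} {f = f} {f'} {t} {t'} f≡f' t≡t' =
    ≈-reflexive (trans (⟦app⟧ u f t) (trans (cong₂ _·_ f≡f' t≡t') (sym (⟦app⟧ v f' t'))))

  imp-cong : ∀ {u v} {φ φ' ψ ψ' : Tm Con o} →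
    ⟦ φ ⟧ u ≈[ o ] ⟦ φ' ⟧ v → ⟦ ψ ⟧ u ≈[ o ] ⟦ ψ' ⟧ v → ⟦ imp φ ψ ⟧ u ≈[ o ] ⟦ imp φ' ψ' ⟧ v
  imp-cong {u} {v} {φ} {φ'} {ψ} {ψ'} φ≈φ' ψ≈ψ' s =
    ⇔.trans (⊩-imp s u φ ψ) (⇔.trans later (⇔.sym (⊩-imp s v φ' ψ')))
    where
    later : (∀ s' → s ≤ s' → s' , u ⊩ φ → s' , u ⊩ ψ) ⇔ (∀ s' → s ≤ s' → s' , v ⊩ φ' → s' , v ⊩ ψ')
    later = mk⇔ (λ h s' s≤s' ⊩φ' → to (ψ≈ψ' s') (h s' s≤s' (from (φ≈φ' s') ⊩φ')))
                (λ h s' s≤s' ⊩φ  → from (ψ≈ψ' s') (h s' s≤s' (to (φ≈φ' s') ⊩φ)))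

  all-cong : ∀ {u v} τ (q : Quant τ) {φ φ' : Tm Con o} →
    (∀ d → ⟦ φ ⟧ extend u τ d ≈[ o ] ⟦ φ' ⟧ extend v τ d) → ⟦ all τ q φ ⟧ u ≈[ o ] ⟦ all τ q φ' ⟧ v
  all-cong {u} {v} τ q {φ} {φ'} φ≈φ' s =
    ⇔.trans (⊩-all s u τ q φ) (⇔.trans later (⇔.sym (⊩-all s v τ q φ')))
    where
    later : (∀ s' → s ≤ s' → ∀ d → s' , extend u τ d ⊩ φ) ⇔ (∀ s' → s ≤ s' → ∀ d → s' , extend v τ d ⊩ φ')
    later = mk⇔ (λ h s' s≤s' d → to   (φ≈φ' d s') (h s' s≤s' d))
                (λ h s' s≤s' d → from (φ≈φ' d s') (h s' s≤s' d))

  coincidence : ∀ {u v} → u ≈ᵥ v → ∀ {τ} (t : Tm Con τ) → ⟦ t ⟧ u ≈[ τ ] ⟦ t ⟧ v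
  coincidence u≈v (var τ n)   = var-cong τ n (u≈v τ n)
  coincidence u≈v (con c)     = con-cong c
  coincidence u≈v (app f t)   = app-cong (coincidence u≈v f) (coincidence u≈v t)
  coincidence u≈v (imp φ ψ)   = imp-cong (coincidence u≈v φ) (coincidence u≈v ψ)
  coincidence u≈v (all τ q φ) = all-cong τ q λ d → coincidence (≈ᵥ-extend τ d u≈v) φ

  shift-var : ∀ v σ c τ n → ⟦ shift σ c (var τ n) ⟧ v ≡ skip v σ c τ n
  shift-var v σ c τ n with τ ≟Ty σ
  ... | no _ = ⟦var⟧ v τ n
  ... | yes refl with c ≤? n
  ...   | yes _ = ⟦var⟧ v τ (suc n)
  ...   | no  _ = ⟦var⟧ v τ n

  weakening : ∀ v σ c {τ} (t : Tm Con τ) → ⟦ shift σ c t ⟧ v ≈[ τ ] ⟦ t ⟧ skip v σ c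
  weakening v σ c (var τ n) = ≈-reflexive (trans (shift-var v σ c τ n) (sym (⟦var⟧ (skip v σ c) τ n)))
  weakening v σ c (con a)   = con-cong a
  weakening v σ c (app f t) = app-cong (weakening v σ c f) (weakening v σ c t)
  weakening v σ c (imp φ ψ) = imp-cong (weakening v σ c φ) (weakening v σ c ψ)
  weakening v σ c (all τ q φ) with τ ≟Ty σ
  ... | yes refl = all-cong τ q λ d →
    ≈-trans (weakening (extend v τ d) τ (suc c) φ) (coincidence (≗ᵥ⇒≈ᵥ (skip-extend-≡ v τ c d)) φ)
  ... | no τ≢σ   = all-cong τ q λ d →
    ≈-trans (weakening (extend v τ d) σ c φ) (coincidence (≗ᵥ⇒≈ᵥ (skip-extend-≢ v c d τ≢σ)) φ)

  weakening-zero : ∀ u τ d {σ} (t : Tm Con σ) → ⟦ shift τ 0 t ⟧ extend u τ d ≈[ σ ] ⟦ t ⟧ u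
  weakening-zero u τ d t =
    ≈-trans (weakening (extend u τ d) τ 0 t) (coincidence (≗ᵥ⇒≈ᵥ (skip-extend-zero u τ d)) t)

  subst-var : ∀ u σ n (t : Tm Con σ) τ m → ⟦ var τ m [ σ , n ≔ t ] ⟧ u ≈[ τ ] update u σ n (⟦ t ⟧ u) τ m
  subst-var u σ n t τ m with τ ≟Ty σ | m ℕ.≟ n
  ... | yes refl | yes _ = ≈-refl τ
  ... | yes refl | no  _ = ≈-reflexive (⟦var⟧ u τ m)
  ... | no  _    | yes _ = ≈-reflexive (⟦var⟧ u τ m)
  ... | no  _    | no  _ = ≈-reflexive (⟦var⟧ u τ m)

  update-under-binder : ∀ u σ n n' (t : Tm Con σ) τ d →
    update (extend u τ d) σ n' (⟦ t ⟧ u) ≗ᵥ extend (update u σ n (⟦ t ⟧ u)) τ d →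
    update (extend u τ d) σ n' (⟦ shift τ 0 t ⟧ extend u τ d) ≈ᵥ extend (update u σ n (⟦ t ⟧ u)) τ d
  update-under-binder u σ n n' t τ d commute =
    ≈ᵥ-trans (≈ᵥ-update (extend u τ d) σ n' (weakening-zero u τ d t)) (≗ᵥ⇒≈ᵥ commute)

  substitution : ∀ u σ n (t : Tm Con σ) {τ} (φ : Tm Con τ) →
    ⟦ φ [ σ , n ≔ t ] ⟧ u ≈[ τ ] ⟦ φ ⟧ update u σ n (⟦ t ⟧ u)
  substitution u σ n t (var τ m) = ≈-trans (subst-var u σ n t τ m) (≈-reflexive (sym (⟦var⟧ _ τ m)))
  substitution u σ n t (con a)   = con-cong a
  substitution u σ n t (app f s) = app-cong (substitution u σ n t f) (substitution u σ n t s)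
  substitution u σ n t (imp φ ψ) = imp-cong (substitution u σ n t φ) (substitution u σ n t ψ)
  substitution u σ n t (all τ q φ) with τ ≟Ty σ
  ... | yes refl = all-cong τ q λ d →
    ≈-trans (substitution (extend u τ d) τ (suc n) (shift τ 0 t) φ)
            (coincidence (update-under-binder u τ n (suc n) t τ d (update-extend-≡ u τ n (⟦ t ⟧ u) d)) φ)
  ... | no τ≢σ   = all-cong τ q λ d →
    ≈-trans (substitution (extend u τ d) σ n (shift τ 0 t) φ)
            (coincidence (update-under-binder u σ n n t τ d (update-extend-≢ u n (⟦ t ⟧ u) d τ≢σ)) φ)

mainTheorem9 : ∀ {k : ℕ} (Con : Ty k → Set) → ((τ : Ty k) → Con τ ↣ ℕ) →
    (M : PreModel Con) → IsKripke M →
    let open PreModel M in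
    ∀ (u : Valuation D) (σ : Ty k) (x : ℕ) (t : Tm Con σ) (φ : Tm Con o) (s : S) →
      (s , u ⊩ (φ [ σ , x ≔ t ])) ⇔ (s , update u σ x (⟦ t ⟧ u) ⊩ φ)
mainTheorem9 Con _ M K u σ x t φ = Semantics.substitution M K u σ x t φ
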